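{- For each integer $k\ge 2$ there exists a polynomial $\widetilde{P}_k(x)$ (in $x$, with coefficients depending on $b$) such that \[ C(x)=\frac{\widetilde{P}_k(x)}{\det(I-A(x))}. \]
   Context: $\mathrm{TComp}(n,k)$ is the set of compositions of $n$ with all parts at most $k-1$ and every two consecutive parts summing to at least $k$ (the empty composition for $n=0$). Set $c(n)=\sum_{\beta\in\mathrm{TComp}(n,k)}b^{k\ell(\beta)}$, where $\ell(\beta)$ is the number of parts, and $C(x)=\sum_{n\ge0}c(n)x^n$. $A(x)=(a_{ij})$ is the $(k-1)\times(k-1)$ matrix with $a_{ij}=b^kx^j$ if $i+j\ge k$ and $a_{ij}=0$ otherwise; $I$ is the identity matrix. -}

module Defs where

open import Level using (_⊔_)
open import Algebra.Bundles using (CommutativeRing)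
open import Data.Nat as ℕ using (ℕ; zero; suc; _∸_; _≤_; _≤?_; _≟_)
open import Data.Fin using (Fin; toℕ; punchIn)
import Data.Fin as Fin
open import Data.List using (List; []; _∷_; _++_; map; filter; length)
open import Data.Bool using (Bool; true; false; if_then_else_)
open import Data.Product using (_×_; _,_)
open import Data.Unit using (⊤)
open import Relation.Nullary using (Dec; yes; no; does)
open import Relation.Nullary.Decidable using (_×-dec_)
open import Relation.Unary using (Decidable)
open import Data.Unit using (tt)

incHead : List ℕ → List ℕ
incHead []       = []
incHead (p ∷ ps) = suc p ∷ ps

-- comps n : the list of ALL compositions of n (lists of positive parts
-- summing to n), each exactly once.  A composition of n+1 either starts
-- with the part 1 (followed by a composition of n), or is obtained from a
-- nonempty composition of n by increasing its first part.
nonEmpty : List (List ℕ) → List (List ℕ)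
nonEmpty []             = []
nonEmpty ([] ∷ xs)      = nonEmpty xs
nonEmpty ((p ∷ ps) ∷ xs) = (p ∷ ps) ∷ nonEmpty xs

comps : ℕ → List (List ℕ)
comps zero    = [] ∷ []
comps (suc n) = map (1 ∷_) (comps n) ++ map incHead (nonEmpty (comps n))

AllPartsSmall : ℕ → List ℕ → Set
AllPartsSmall k []       = ⊤
AllPartsSmall k (p ∷ ps) = (p ≤ k ∸ 1) × AllPartsSmall k ps

ConsecBig : ℕ → List ℕ → Set
ConsecBig k []             = ⊤
ConsecBig k (p ∷ [])       = ⊤
ConsecBig k (p ∷ q ∷ ps)   = (k ≤ p ℕ.+ q) × ConsecBig k (q ∷ ps)

allPartsSmall? : ∀ k → Decidable (AllPartsSmall k)
allPartsSmall? k []       = yes tt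
allPartsSmall? k (p ∷ ps) = (p ≤? k ∸ 1) ×-dec allPartsSmall? k ps

consecBig? : ∀ k → Decidable (ConsecBig k)
consecBig? k []           = yes tt
consecBig? k (p ∷ [])     = yes tt
consecBig? k (p ∷ q ∷ ps) = (k ≤? p ℕ.+ q) ×-dec consecBig? k (q ∷ ps)

IsT : ℕ → List ℕ → Set
IsT k β = AllPartsSmall k β × ConsecBig k β

isT? : ∀ k → Decidable (IsT k)
isT? k β = allPartsSmall? k β ×-dec consecBig? k β

TComp : ℕ → ℕ → List (List ℕ)
TComp n k = filter (isT? k) (comps n)

module Series {c ℓ} (R : CommutativeRing c ℓ) where
  open CommutativeRing R

  pow : Carrier → ℕ → Carrier
  pow a zero    = 1#
  pow a (suc n) = a * pow a n

  sumList : List Carrier → Carrier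
  sumList []       = 0#
  sumList (x ∷ xs) = x + sumList xs

  sumUpTo : ℕ → (ℕ → Carrier) → Carrier
  sumUpTo zero    f = f 0
  sumUpTo (suc n) f = sumUpTo n f + f (suc n)

  PS : Set c
  PS = ℕ → Carrier

  _+ₛ_ : PS → PS → PS
  (f +ₛ g) n = f n + g n

  -ₛ_ : PS → PS
  (-ₛ f) n = - f n

  _*ₛ_ : PS → PS → PS
  (f *ₛ g) n = sumUpTo n (λ i → f i * g (n ∸ i))

  0ₛ : PS
  0ₛ n = 0#

  mono : Carrier → ℕ → PS
  mono a j n = if does (n ≟ j) then a else 0#

  1ₛ : PS
  1ₛ = mono 1# 0

  poly : List Carrier → PS
  poly []       n       = 0#
  poly (p ∷ ps) zero    = p
  poly (p ∷ ps) (suc n) = poly ps n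

  sumFin : ∀ n → (Fin n → PS) → PS
  sumFin zero    f = 0ₛ
  sumFin (suc n) f = f Fin.zero +ₛ sumFin n (λ i → f (Fin.suc i))

  sign : ∀ {n} → Fin n → PS → PS
  sign Fin.zero    s = s
  sign (Fin.suc j) s = -ₛ sign j s

  det : ∀ n → (Fin n → Fin n → PS) → PS
  det zero    M = 1ₛ
  det (suc n) M = sumFin (suc n) (λ j →
    sign j (M Fin.zero j *ₛ det n (λ r s → M (Fin.suc r) (punchIn j s))))

  C : (b : Carrier) (k : ℕ) → PS
  C b k n = sumList (map (λ β → pow b (k ℕ.* length β)) (TComp n k))

  -- A(x): (k-1)×(k-1), rows/columns indexed i,j ∈ {1,…,k-1}
  -- (Fin index i' represents i = toℕ i' + 1); a_ij = b^k x^j if i+j ≥ k, else 0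
  A : (b : Carrier) (k : ℕ) → Fin (k ∸ 1) → Fin (k ∸ 1) → PS
  A b k i j =
    if does (k ≤? suc (toℕ i) ℕ.+ suc (toℕ j))
    then mono (pow b k) (suc (toℕ j))
    else 0ₛ

  IminusA : (b : Carrier) (k : ℕ) → Fin (k ∸ 1) → Fin (k ∸ 1) → PS
  IminusA b k i j = (if does (toℕ i ≟ toℕ j) then 1ₛ else 0ₛ) +ₛ (-ₛ A b k i j)

  detIminusA : (b : Carrier) (k : ℕ) → PS
  detIminusA b k = det (k ∸ 1) (IminusA b k)

{-# OPTIONS --safe #-}
-- Group the T-compositions by their first part p ∈ {1, …, k-1}. If G_p(x) is the generating function
-- of those starting with p, then C = 1 + Σ_p G_p, and removing the first part gives the linear system
-- G_p = b^k x^p + Σ_q G_q a_qp(x), i.e. G (I - A) = u with u_p = b^k x^p. By Cramer's rule,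
-- det(I - A) G_p is the determinant of I - A with row p replaced by u, a polynomial; hence so is
-- det(I - A) C. Determinants are Laplace expansions along the first row, and the alternating property
-- behind Cramer's rule comes from comparing the expansions along the first two rows in either order.
module Submission where

open import Defs
open import Algebra.Bundles using (CommutativeRing)
import Algebra.Properties.Semiring.Sum
open import Data.Bool using (true; false; if_then_else_; _∧_)
open import Data.Fin as Fin using (Fin; zero; suc; toℕ; punchIn; lift)
open import Data.Fin.Properties using (punchInᵢ≢i; suc-injective; toℕ<n; toℕ-injective)
open import Data.List using (List; []; _∷_; _++_; map; filter; length; applyUpTo)
open import Data.List.Properties using (map-++; map-∘)
open import Data.Nat using (ℕ; _≤_)
open import Data.Nat as ℕ using (zero; suc; _∸_; _<_; z≤n; s≤s)
import Data.Nat.Properties as ℕₚ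
open import Data.Product using (∃; _,_; _×_)
open import Data.Vec.Functional using (updateAt)
open import Data.Vec.Functional.Properties using (updateAt-updates; updateAt-minimal; updateAt-id-local)
open import Function using (_∘_; const)
open import Function.Bundles using (_⇔_; mk⇔)
open import Relation.Binary.PropositionalEquality as ≡ using (_≡_; _≢_; _≗_)
open import Relation.Nullary using (¬_; yes; no; does; contradiction)
open import Relation.Nullary.Decidable using (dec-true; dec-false; does-⇔; _×-dec_)
open import Relation.Unary using (Decidable)

module Sums {c ℓ} (R : CommutativeRing c ℓ) where

  open CommutativeRing R hiding (zero)
  open Series R using (sumUpTo)
  open import Algebra.Properties.Ring ring using (-0#≈0#; -‿+-comm)
  open import Algebra.Properties.CommutativeSemigroup +-commutativeSemigroup using (interchange)
  open import Algebra.Properties.Semiring.Sum semiring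
    using (sum; sum-syntax; sum-cong-≋; sum-replicate-zero; sum-remove)
  open import Relation.Binary.Reasoning.Setoid setoid

  ∑-zero : ∀ {n} {f : Fin n → Carrier} → (∀ i → f i ≈ 0#) → sum f ≈ 0#
  ∑-zero {n} f≈0 = trans (sum-cong-≋ f≈0) (sum-replicate-zero n)

  -‿∑ : ∀ {n} (f : Fin n → Carrier) → - sum f ≈ ∑[ i < n ] (- f i)
  -‿∑ {zero}  f = -0#≈0#
  -‿∑ {suc n} f = trans (sym (-‿+-comm _ _)) (+-congˡ (-‿∑ (f ∘ suc)))

  ∑-single : ∀ {n} (j : Fin n) (f : Fin n → Carrier) → (∀ i → i ≢ j → f i ≈ 0#) → sum f ≈ f j
  ∑-single {suc n} j f f≈0 = begin
    sum f                              ≈⟨ sum-remove {i = j} f ⟩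
    f j + ∑[ i < n ] f (punchIn j i)   ≈⟨ +-congˡ (∑-zero λ i → f≈0 (punchIn j i) (punchInᵢ≢i j i)) ⟩
    f j + 0#                           ≈⟨ +-identityʳ _ ⟩
    f j                                ∎

  sumUpTo-cong : ∀ n {f g : ℕ → Carrier} → (∀ i → i ≤ n → f i ≈ g i) → sumUpTo n f ≈ sumUpTo n g
  sumUpTo-cong zero    f≈g = f≈g 0 z≤n
  sumUpTo-cong (suc n) f≈g =
    +-cong (sumUpTo-cong n λ i i≤n → f≈g i (ℕₚ.m≤n⇒m≤1+n i≤n)) (f≈g (suc n) ℕₚ.≤-refl)

  sumUpTo-zero : ∀ n {f : ℕ → Carrier} → (∀ i → f i ≈ 0#) → sumUpTo n f ≈ 0#
  sumUpTo-zero zero    f≈0 = f≈0 0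
  sumUpTo-zero (suc n) f≈0 = trans (+-cong (sumUpTo-zero n f≈0) (f≈0 (suc n))) (+-identityʳ 0#)

  sumUpTo-+ : ∀ n (f g : ℕ → Carrier) → sumUpTo n (λ i → f i + g i) ≈ sumUpTo n f + sumUpTo n g
  sumUpTo-+ zero    f g = refl
  sumUpTo-+ (suc n) f g = trans (+-congʳ (sumUpTo-+ n f g)) (interchange _ _ _ _)

  *-distribˡ-sumUpTo : ∀ n x (f : ℕ → Carrier) → x * sumUpTo n f ≈ sumUpTo n (λ i → x * f i)
  *-distribˡ-sumUpTo zero    x f = refl
  *-distribˡ-sumUpTo (suc n) x f = trans (distribˡ x _ _) (+-congʳ (*-distribˡ-sumUpTo n x f))

  sumUpTo-suc : ∀ n (f : ℕ → Carrier) → sumUpTo (suc n) f ≈ f 0 + sumUpTo n (f ∘ suc)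
  sumUpTo-suc zero    f = refl
  sumUpTo-suc (suc n) f = trans (+-congʳ (sumUpTo-suc n f)) (+-assoc _ _ _)

  sumUpTo-reverse : ∀ n (f : ℕ → Carrier) → sumUpTo n f ≈ sumUpTo n (λ i → f (n ∸ i))
  sumUpTo-reverse zero    f = refl
  sumUpTo-reverse (suc n) f = begin
    sumUpTo n f + f (suc n)                    ≈⟨ +-comm _ _ ⟩
    f (suc n) + sumUpTo n f                    ≈⟨ +-congˡ (sumUpTo-reverse n f) ⟩
    f (suc n) + sumUpTo n (λ i → f (n ∸ i))    ≈⟨ sym (sumUpTo-suc n λ i → f (suc n ∸ i)) ⟩
    sumUpTo (suc n) (λ i → f (suc n ∸ i))      ∎

  sumUpTo≈∑ : ∀ n (f : ℕ → Carrier) → sumUpTo n f ≈ ∑[ i < suc n ] f (toℕ i)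
  sumUpTo≈∑ zero    f = sym (+-identityʳ _)
  sumUpTo≈∑ (suc n) f = trans (sumUpTo-suc n f) (+-congˡ (sumUpTo≈∑ n (f ∘ suc)))

  ∑-toℕ-truncate : ∀ N d (f : ℕ → Carrier) → (∀ i → N ≤ i → f i ≈ 0#) →
    ∑[ i < N ℕ.+ d ] f (toℕ i) ≈ ∑[ i < N ] f (toℕ i)
  ∑-toℕ-truncate zero    d f f≈0 = ∑-zero {d} λ i → f≈0 (toℕ i) z≤n
  ∑-toℕ-truncate (suc N) d f f≈0 =
    +-congˡ (∑-toℕ-truncate N d (f ∘ suc) λ i N≤i → f≈0 (suc i) (s≤s N≤i))

  sumUpTo-as-∑ : ∀ m N (f : ℕ → Carrier) →
    (∀ i → m < i → f i ≈ 0#) → (∀ i → N ≤ i → f i ≈ 0#) → sumUpTo m f ≈ ∑[ i < N ] f (toℕ i)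
  sumUpTo-as-∑ m N f f≈0 f≈0′ = begin
    sumUpTo m f                          ≈⟨ sumUpTo≈∑ m f ⟩
    ∑[ i < suc m ] f (toℕ i)             ≈⟨ sym (∑-toℕ-truncate (suc m) N f f≈0) ⟩
    ∑[ i < suc m ℕ.+ N ] f (toℕ i)       ≡⟨ ≡.cong (λ L → ∑[ i < L ] f (toℕ i)) (ℕₚ.+-comm (suc m) N) ⟩
    ∑[ i < N ℕ.+ suc m ] f (toℕ i)       ≈⟨ ∑-toℕ-truncate N (suc m) f f≈0′ ⟩
    ∑[ i < N ] f (toℕ i)                 ∎

module Determinant {c ℓ} (R : CommutativeRing c ℓ) where

  open CommutativeRing R hiding (zero)
  open import Algebra.Properties.Ring ring
    using (-0#≈0#; -‿involutive; -‿+-comm; ⁻¹-anti-homo‿-; -‿distribʳ-*)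
  open Sums R using (∑-zero; -‿∑; ∑-single)
  open import Algebra.Properties.CommutativeSemigroup *-commutativeSemigroup using (x∙yz≈y∙xz)
  open import Algebra.Properties.Semiring.Sum semiring
    using (sum; sum-syntax; sum-cong-≋; ∑-distrib-+; ∑-comm; *-distribˡ-sum; *-distribʳ-sum)
  open import Relation.Binary.Reasoning.Setoid setoid

  Matrix : ℕ → Set c
  Matrix n = Fin n → Fin n → Carrier

  sign : ∀ {n} → Fin n → Carrier → Carrier
  sign zero    x = x
  sign (suc j) x = - sign j x

  minor : ∀ {n} → Fin (suc n) → Fin (suc n) → Matrix (suc n) → Matrix n
  minor i j M r s = M (punchIn i r) (punchIn j s)

  det : ∀ n → Matrix n → Carrier
  det zero    M = 1#
  det (suc n) M = ∑[ j < suc n ] sign j (M zero j * det n (minor zero j M))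

  sign-cong : ∀ {n} (j : Fin n) {x y} → x ≈ y → sign j x ≈ sign j y
  sign-cong zero    x≈y = x≈y
  sign-cong (suc j) x≈y = -‿cong (sign-cong j x≈y)

  sign-* : ∀ {n} (j : Fin n) x y → x * sign j y ≈ sign j (x * y)
  sign-* zero    x y = refl
  sign-* (suc j) x y = trans (sym (-‿distribʳ-* x _)) (-‿cong (sign-* j x y))

  sign-suc-suc : ∀ {m n} (i : Fin m) (j : Fin n) x → sign (suc i) (sign (suc j) x) ≈ sign i (sign j x)
  sign-suc-suc zero    j x = -‿involutive _
  sign-suc-suc (suc i) j x = -‿cong (sign-suc-suc i j x)

  sign-∑ : ∀ {m n} (j : Fin m) (f : Fin n → Carrier) → sign j (sum f) ≈ ∑[ i < n ] sign j (f i)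
  sign-∑ zero    f = refl
  sign-∑ (suc j) f = trans (-‿cong (sign-∑ j f)) (-‿∑ λ i → sign j (f i))

  sign-*-∑ : ∀ {m n} (j : Fin m) x (f : Fin n → Carrier) → sign j (x * sum f) ≈ ∑[ i < n ] sign j (x * f i)
  sign-*-∑ j x f = trans (sign-cong j (*-distribˡ-sum x f)) (sign-∑ j λ i → x * f i)

  sign-*-zero : ∀ {n} (j : Fin n) x {y} → y ≈ 0# → sign j (x * y) ≈ 0#
  sign-*-zero zero    x y≈0 = trans (*-congˡ y≈0) (zeroʳ x)
  sign-*-zero (suc j) x y≈0 = trans (-‿cong (sign-*-zero j x y≈0)) -0#≈0#

  det-cong : ∀ n {M N : Matrix n} → (∀ r s → M r s ≈ N r s) → det n M ≈ det n N
  det-cong zero    M≈N = refl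
  det-cong (suc n) M≈N = sum-cong-≋ λ j → sign-cong j
    (*-cong (M≈N zero j) (det-cong n λ r s → M≈N (suc r) (punchIn j s)))

  -- W a b σ is a weight for using column a in row 0, column b in row 1 and columns σ in the other rows.
  PairWeight : ℕ → Set c
  PairWeight n = Fin (suc (suc n)) → Fin (suc (suc n)) → (Fin n → Fin (suc (suc n))) → Carrier

  Extensional : ∀ {n} → PairWeight n → Set ℓ
  Extensional W = ∀ a b {σ τ} → σ ≗ τ → W a b σ ≈ W a b τ

  transpose : ∀ {n} → PairWeight n → PairWeight n
  transpose W a b = W b a

  restrict : ∀ {n} → PairWeight (suc n) → PairWeight n
  restrict W a b σ = W (suc a) (suc b) (lift 1 σ)

  restrict-extensional : ∀ {n} (W : PairWeight (suc n)) → Extensional W → Extensional (restrict W)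
  restrict-extensional W ext a b σ≗τ =
    ext (suc a) (suc b) λ { zero → ≡.refl ; (suc s) → ≡.cong suc (σ≗τ s) }

  punchIn-suc-suc : ∀ {n} (a : Fin (suc (suc n))) (b : Fin (suc n)) →
    punchIn (suc a) ∘ punchIn (suc b) ≗ lift 1 (punchIn a ∘ punchIn b)
  punchIn-suc-suc a b zero    = ≡.refl
  punchIn-suc-suc a b (suc s) = ≡.refl

  expand₀₁ : ∀ n → PairWeight n → Carrier
  expand₀₁ n W = ∑[ a < suc (suc n) ] ∑[ b < suc n ]
    sign a (sign b (W a (punchIn a b) (punchIn a ∘ punchIn b)))

  column₀ : ∀ {n} → PairWeight n → Carrier
  column₀ {n} W = ∑[ b < suc n ] sign b (W zero (suc b) (suc ∘ punchIn b))

  difference : ∀ {n} → PairWeight n → Carrier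
  difference W = column₀ W - column₀ (transpose W)

  -- The sum over column pairs a < b of ±(W a b σ - W b a σ), grouped by the smaller column a.
  pairSum : ∀ n → PairWeight n → Carrier
  pairSum zero    W = difference W
  pairSum (suc n) W = difference W + pairSum n (restrict W)

  expand₀₁-zero : (W : PairWeight 0) → Extensional W → expand₀₁ 0 W ≈ pairSum 0 W
  expand₀₁-zero W ext = +-cong (+-congʳ (ext _ _ λ ())) (begin
    (- W (suc zero) zero _ + 0#) + 0#   ≈⟨ +-identityʳ _ ⟩
    - W (suc zero) zero _ + 0#          ≈⟨ +-identityʳ _ ⟩
    - W (suc zero) zero _               ≈⟨ -‿cong (trans (ext _ _ λ ()) (sym (+-identityʳ _))) ⟩
    - (W (suc zero) zero _ + 0#)        ∎)

  -- Terms with a = 0 form column₀ W, terms with b = 0 form column₀ (transpose W) with the opposite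
  -- sign, and the remaining terms are the expansion of restrict W.
  expand₀₁-suc : ∀ {n} (W : PairWeight (suc n)) → Extensional W →
    expand₀₁ (suc n) W ≈ column₀ W + (- column₀ (transpose W) + expand₀₁ n (restrict W))
  expand₀₁-suc {n} W ext = +-congˡ (begin
    ∑[ a < suc (suc n) ] (- transposedTerm a + rest′ a)
      ≈⟨ sum-cong-≋ (λ a → +-congˡ {x = - transposedTerm a} (sum-cong-≋ λ b → trans (sign-suc-suc a b _)
           (sign-cong a (sign-cong b (ext (suc a) (suc (punchIn a b)) (punchIn-suc-suc a b)))))) ⟩
    ∑[ a < suc (suc n) ] (- transposedTerm a + rest a)
      ≈⟨ ∑-distrib-+ (λ a → - transposedTerm a) rest ⟩
    ∑[ a < suc (suc n) ] (- transposedTerm a) + expand₀₁ n (restrict W)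
      ≈⟨ +-congʳ (sym (-‿∑ transposedTerm)) ⟩
    - column₀ (transpose W) + expand₀₁ n (restrict W) ∎)
    where
    transposedTerm rest′ rest : Fin (suc (suc n)) → Carrier
    transposedTerm a = sign a (W (suc a) zero (suc ∘ punchIn a))
    rest′ a = ∑[ b < suc n ] sign (suc a) (sign (suc b)
      (W (suc a) (suc (punchIn a b)) (punchIn (suc a) ∘ punchIn (suc b))))
    rest a = ∑[ b < suc n ] sign a (sign b (restrict W a (punchIn a b) (punchIn a ∘ punchIn b)))

  expand₀₁≈pairSum : ∀ n (W : PairWeight n) → Extensional W → expand₀₁ n W ≈ pairSum n W
  expand₀₁≈pairSum zero    W ext = expand₀₁-zero W ext
  expand₀₁≈pairSum (suc n) W ext = begin
    expand₀₁ (suc n) W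
      ≈⟨ expand₀₁-suc W ext ⟩
    column₀ W + (- column₀ (transpose W) + expand₀₁ n (restrict W))
      ≈⟨ sym (+-assoc _ _ _) ⟩
    difference W + expand₀₁ n (restrict W)
      ≈⟨ +-congˡ (expand₀₁≈pairSum n (restrict W) (restrict-extensional W ext)) ⟩
    pairSum (suc n) W ∎

  pairSum-transpose : ∀ n (W : PairWeight n) → pairSum n (transpose W) ≈ - pairSum n W
  pairSum-transpose zero    W = sym (⁻¹-anti-homo‿- _ _)
  pairSum-transpose (suc n) W =
    trans (+-cong (sym (⁻¹-anti-homo‿- _ _)) (pairSum-transpose n (restrict W))) (-‿+-comm _ _)

  difference-symmetric : ∀ {n} (W : PairWeight n) → (∀ a b σ → W a b σ ≈ W b a σ) → difference W ≈ 0#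
  difference-symmetric W sym-W = trans
    (+-congʳ (sum-cong-≋ λ b → sign-cong b (sym-W zero (suc b) (suc ∘ punchIn b))))
    (-‿inverseʳ _)

  pairSum-symmetric : ∀ n (W : PairWeight n) → (∀ a b σ → W a b σ ≈ W b a σ) → pairSum n W ≈ 0#
  pairSum-symmetric zero    W sym-W = difference-symmetric W sym-W
  pairSum-symmetric (suc n) W sym-W = trans
    (+-cong (difference-symmetric W sym-W) (pairSum-symmetric n (restrict W) λ a b σ → sym-W _ _ _))
    (+-identityʳ 0#)

  laplaceWeight : ∀ {n} → Matrix (suc (suc n)) → PairWeight n
  laplaceWeight {n} M a b σ = M zero a * (M (suc zero) b * det n λ r s → M (suc (suc r)) (σ s))

  laplaceWeight-extensional : ∀ {n} (M : Matrix (suc (suc n))) → Extensional (laplaceWeight M)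
  laplaceWeight-extensional {n} M a b σ≗τ =
    *-congˡ (*-congˡ (det-cong n λ r s → reflexive (≡.cong (M (suc (suc r))) (σ≗τ s))))

  det≈expand₀₁ : ∀ {n} (M : Matrix (suc (suc n))) → det (suc (suc n)) M ≈ expand₀₁ n (laplaceWeight M)
  det≈expand₀₁ {n} M = sum-cong-≋ λ a → trans
    (sign-*-∑ a (M zero a) λ b → sign b (y a b))
    (sum-cong-≋ λ b → sign-cong a (sign-* b (M zero a) (y a b)))
    where
    y : Fin (suc (suc n)) → Fin (suc n) → Carrier
    y a b = M (suc zero) (punchIn a b) * det n (minor zero b (minor zero a M))

  det-expand-row₁ : ∀ {n} (M : Matrix (suc (suc n))) →
    det (suc (suc n)) M ≈ ∑[ b < suc (suc n) ] sign (suc b) (M (suc zero) b * det (suc n) (minor (suc zero) b M))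
  det-expand-row₁ {n} M = begin
    det (suc (suc n)) M
      ≈⟨ det≈expand₀₁ M ⟩
    expand₀₁ n W
      ≈⟨ expand₀₁≈pairSum n W (laplaceWeight-extensional M) ⟩
    pairSum n W
      ≈⟨ sym (-‿involutive _) ⟩
    - - pairSum n W
      ≈⟨ -‿cong (sym (pairSum-transpose n W)) ⟩
    - pairSum n (transpose W)
      ≈⟨ -‿cong (sym (expand₀₁≈pairSum n (transpose W) λ a b → laplaceWeight-extensional M b a)) ⟩
    - expand₀₁ n (transpose W)
      ≈⟨ -‿∑ (λ b → ∑[ a < suc n ] sign b (sign a (W (punchIn b a) b (punchIn b ∘ punchIn a)))) ⟩
    ∑[ b < suc (suc n) ] (- ∑[ a < suc n ] sign b (sign a (W (punchIn b a) b (punchIn b ∘ punchIn a))))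
      ≈⟨ sum-cong-≋ (λ b → -‿cong (sym (expandMinor b))) ⟩
    ∑[ b < suc (suc n) ] sign (suc b) (M (suc zero) b * det (suc n) (minor (suc zero) b M)) ∎
    where
    W = laplaceWeight M
    expandMinor : ∀ b → sign b (M (suc zero) b * det (suc n) (minor (suc zero) b M))
                      ≈ ∑[ a < suc n ] sign b (sign a (W (punchIn b a) b (punchIn b ∘ punchIn a)))
    expandMinor b = trans (sign-*-∑ b (M (suc zero) b) λ a → sign a (M zero (punchIn b a) * D a))
      (sum-cong-≋ λ a → sign-cong b (trans (sign-* a (M (suc zero) b) _)
        (sign-cong a (x∙yz≈y∙xz (M (suc zero) b) (M zero (punchIn b a)) (D a)))))
      where
      D : Fin (suc n) → Carrier
      D a = det n (minor zero a (minor (suc zero) b M))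

  det-equalRows₀ : ∀ n (M : Matrix (suc n)) j → (∀ s → M zero s ≈ M (suc j) s) → det (suc n) M ≈ 0#
  det-equalRows₀ (suc n) M zero    row₀≈row₁ = begin
    det (suc (suc n)) M                  ≈⟨ det≈expand₀₁ M ⟩
    expand₀₁ n (laplaceWeight M)         ≈⟨ expand₀₁≈pairSum n _ (laplaceWeight-extensional M) ⟩
    pairSum n (laplaceWeight M)          ≈⟨ pairSum-symmetric n _ symmetric ⟩
    0#                                   ∎
    where
    symmetric : ∀ a b σ → laplaceWeight M a b σ ≈ laplaceWeight M b a σ
    symmetric a b σ = trans (*-cong (row₀≈row₁ a) (*-congʳ (sym (row₀≈row₁ b)))) (x∙yz≈y∙xz _ _ _)
  -- Expanding along row 1 keeps both equal rows in every minor.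
  det-equalRows₀ (suc n) M (suc j) row₀≈rowⱼ = trans (det-expand-row₁ M) (∑-zero λ b →
    sign-*-zero (suc b) (M (suc zero) b)
      (det-equalRows₀ n (minor (suc zero) b M) j λ s → row₀≈rowⱼ (punchIn b s)))

  det-equalRows : ∀ n (M : Matrix n) {i j} → i ≢ j → (∀ s → M i s ≈ M j s) → det n M ≈ 0#
  det-equalRows (suc n) M {zero}  {zero}  i≢j _     = contradiction ≡.refl i≢j
  det-equalRows (suc n) M {zero}  {suc j} _   rows≈ = det-equalRows₀ n M j rows≈
  det-equalRows (suc n) M {suc i} {zero}  _   rows≈ = det-equalRows₀ n M i λ s → sym (rows≈ s)
  det-equalRows (suc n) M {suc i} {suc j} i≢j rows≈ = ∑-zero λ a → sign-*-zero a (M zero a)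
    (det-equalRows n (minor zero a M) (i≢j ∘ ≡.cong suc) λ s → rows≈ (punchIn a s))

  ∑-sign-linear : ∀ {n m} (g : Fin m → Carrier) (y : Fin n → Fin m → Carrier) →
    ∑[ a < n ] sign a (∑[ i < m ] (g i * y a i)) ≈ ∑[ i < m ] (g i * ∑[ a < n ] sign a (y a i))
  ∑-sign-linear {n} {m} g y = begin
    ∑[ a < n ] sign a (∑[ i < m ] (g i * y a i))  ≈⟨ sum-cong-≋ (λ a → sign-∑ a λ i → g i * y a i) ⟩
    ∑[ a < n ] ∑[ i < m ] sign a (g i * y a i)  ≈⟨ ∑-comm (λ a i → sign a (g i * y a i)) ⟩
    ∑[ i < m ] ∑[ a < n ] sign a (g i * y a i)  ≈⟨ sum-cong-≋ (λ i → sym (trans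
                                                      (*-distribˡ-sum (g i) λ a → sign a (y a i))
                                                      (sum-cong-≋ λ a → sign-* a (g i) (y a i)))) ⟩
    ∑[ i < m ] (g i * ∑[ a < n ] sign a (y a i))  ∎

  det-linear-byFirstRow : ∀ {n m} (X : Matrix (suc n)) (Y : Fin m → Matrix (suc n)) (g : Fin m → Carrier) →
    (∀ a → X zero a * det n (minor zero a X) ≈ ∑[ i < m ] (g i * (Y i zero a * det n (minor zero a (Y i))))) →
    det (suc n) X ≈ ∑[ i < m ] (g i * det (suc n) (Y i))
  det-linear-byFirstRow {n} X Y g terms = trans (sum-cong-≋ λ a → sign-cong a (terms a))
    (∑-sign-linear g λ a i → Y i zero a * det n (minor zero a (Y i)))

  det-linearInRow : ∀ n {m} (j : Fin n) (X : Matrix n) (Y : Fin m → Matrix n) (g : Fin m → Carrier) →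
    (∀ i r → r ≢ j → ∀ s → X r s ≈ Y i r s) →
    (∀ s → X j s ≈ ∑[ i < m ] (g i * Y i j s)) →
    det n X ≈ ∑[ i < m ] (g i * det n (Y i))
  det-linearInRow (suc n) {m} zero X Y g others row = det-linear-byFirstRow X Y g λ a →
    let D = det n (minor zero a X) in begin
    X zero a * D                           ≈⟨ *-congʳ (row a) ⟩
    (∑[ i < m ] (g i * Y i zero a)) * D     ≈⟨ *-distribʳ-sum D (λ i → g i * Y i zero a) ⟩
    ∑[ i < m ] ((g i * Y i zero a) * D)    ≈⟨ sum-cong-≋ (λ i → trans (*-assoc (g i) (Y i zero a) D)
                                                (*-congˡ (*-congˡ (det-cong n λ r s →
                                                  others i (suc r) (λ ()) (punchIn a s))))) ⟩
    ∑[ i < m ] (g i * (Y i zero a * det n (minor zero a (Y i)))) ∎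
  det-linearInRow (suc n) {m} (suc j) X Y g others row = det-linear-byFirstRow X Y g λ a →
    let D = λ i → det n (minor zero a (Y i)) in begin
    X zero a * det n (minor zero a X)
      ≈⟨ *-congˡ (det-linearInRow n j (minor zero a X) (minor zero a ∘ Y) g
           (λ i r r≢j s → others i (suc r) (r≢j ∘ suc-injective) (punchIn a s))
           (λ s → row (punchIn a s))) ⟩
    X zero a * ∑[ i < m ] (g i * D i)
      ≈⟨ *-distribˡ-sum (X zero a) (λ i → g i * D i) ⟩
    ∑[ i < m ] (X zero a * (g i * D i))
      ≈⟨ sum-cong-≋ (λ i → trans (x∙yz≈y∙xz (X zero a) (g i) (D i))
           (*-congˡ (*-congʳ (others i zero (λ ()) a)))) ⟩
    ∑[ i < m ] (g i * (Y i zero a * D i)) ∎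

  replaceRow : ∀ {n} → Fin n → (Fin n → Carrier) → Matrix n → Matrix n
  replaceRow j v M = updateAt M j (const v)

  replaceRow-updates : ∀ {n} j v (M : Matrix n) s → replaceRow j v M j s ≈ v s
  replaceRow-updates j v M s = reflexive (≡.cong-app (updateAt-updates j {f = const v} M) s)

  replaceRow-minimal : ∀ {n} {r j} v (M : Matrix n) → r ≢ j → ∀ s → replaceRow j v M r s ≈ M r s
  replaceRow-minimal {r = r} {j} v M r≢j s = reflexive (≡.cong-app (updateAt-minimal r j {f = const v} M r≢j) s)

  replaceRow-self : ∀ {n} j (M : Matrix n) r s → replaceRow j (M j) M r s ≈ M r s
  replaceRow-self j M r s = reflexive (≡.cong-app (updateAt-id-local j M ≡.refl r) s)

  cramer : ∀ n (M : Matrix n) (G v : Fin n → Carrier) → (∀ s → v s ≈ ∑[ i < n ] (G i * M i s)) →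
    ∀ j → det n (replaceRow j v M) ≈ G j * det n M
  cramer n M G v v≈ j = begin
    det n (replaceRow j v M)
      ≈⟨ det-linearInRow n j (replaceRow j v M) (λ i → replaceRow j (M i) M) G
           (λ i r r≢j s → trans (replaceRow-minimal v M r≢j s) (sym (replaceRow-minimal (M i) M r≢j s)))
           (λ s → trans (replaceRow-updates j v M s) (trans (v≈ s)
                    (sum-cong-≋ λ i → *-congˡ (sym (replaceRow-updates j (M i) M s))))) ⟩
    ∑[ i < n ] (G i * det n (replaceRow j (M i) M))
      ≈⟨ ∑-single j (λ i → G i * det n (replaceRow j (M i) M)) (λ i i≢j →
           trans (*-congˡ (det-equalRows n _ i≢j λ s →
                   trans (replaceRow-minimal (M i) M i≢j s) (sym (replaceRow-updates j (M i) M s))))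
                 (zeroʳ (G i))) ⟩
    G j * det n (replaceRow j (M j) M)
      ≈⟨ *-congˡ (det-cong n (replaceRow-self j M)) ⟩
    G j * det n M ∎

  module Closure {p} (Q : Carrier → Set p) (Q-0# : Q 0#) (Q-1# : Q 1#) (Q-neg : ∀ {x} → Q x → Q (- x))
           (Q-+ : ∀ {x y} → Q x → Q y → Q (x + y)) (Q-* : ∀ {x y} → Q x → Q y → Q (x * y)) where

    sign-closed : ∀ {n} (j : Fin n) {x} → Q x → Q (sign j x)
    sign-closed zero    Qx = Qx
    sign-closed (suc j) Qx = Q-neg (sign-closed j Qx)

    ∑-closed : ∀ {n} (f : Fin n → Carrier) → (∀ i → Q (f i)) → Q (sum f)
    ∑-closed {zero}  f Qf = Q-0#
    ∑-closed {suc n} f Qf = Q-+ (Qf zero) (∑-closed (f ∘ suc) (Qf ∘ suc))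

    det-closed : ∀ n (M : Matrix n) → (∀ r s → Q (M r s)) → Q (det n M)
    det-closed zero    M QM = Q-1#
    det-closed (suc n) M QM = ∑-closed _ λ j → sign-closed j
      (Q-* (QM zero j) (det-closed n (minor zero j M) λ r s → QM (suc r) (punchIn j s)))

    replaceRow-closed : ∀ {n} j v (M : Matrix n) → (∀ s → Q (v s)) → (∀ r s → Q (M r s)) →
      ∀ r s → Q (replaceRow j v M r s)
    replaceRow-closed j v M Qv QM r s with r Fin.≟ j
    ... | yes ≡.refl = ≡.subst Q (≡.sym (≡.cong-app (updateAt-updates r M) s)) (Qv s)
    ... | no  r≢j    = ≡.subst Q (≡.sym (≡.cong-app (updateAt-minimal r j M r≢j) s)) (QM r s)

module PowerSeries {c ℓ} (R : CommutativeRing c ℓ) where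

  open CommutativeRing R hiding (zero)
  open import Algebra.Properties.Ring ring using (-0#≈0#)
  open import Algebra.Properties.Semiring.Sum semiring using (sum-syntax)
  open Series R
  open Sums R
  open import Relation.Binary.Reasoning.Setoid setoid

  infix 4 _≈ₛ_
  _≈ₛ_ : PS → PS → Set ℓ
  f ≈ₛ g = ∀ n → f n ≈ g n

  *ₛ-cong : ∀ {f f′ g g′} → f ≈ₛ f′ → g ≈ₛ g′ → (f *ₛ g) ≈ₛ (f′ *ₛ g′)
  *ₛ-cong f≈ g≈ n = sumUpTo-cong n λ i _ → *-cong (f≈ i) (g≈ (n ∸ i))

  *ₛ-suc : ∀ n f g → (f *ₛ g) (suc n) ≈ f 0 * g (suc n) + ((f ∘ suc) *ₛ g) n
  *ₛ-suc n f g = sumUpTo-suc n λ i → f i * g (suc n ∸ i)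

  *ₛ-comm : ∀ f g → (f *ₛ g) ≈ₛ (g *ₛ f)
  *ₛ-comm f g n = begin
    sumUpTo n (λ i → f i * g (n ∸ i))
      ≈⟨ sumUpTo-reverse n _ ⟩
    sumUpTo n (λ i → f (n ∸ i) * g (n ∸ (n ∸ i)))
      ≈⟨ sumUpTo-cong n (λ i i≤n → trans (*-comm _ _)
           (*-congʳ (reflexive (≡.cong g (ℕₚ.m∸[m∸n]≡n i≤n))))) ⟩
    sumUpTo n (λ i → g i * f (n ∸ i)) ∎

  *ₛ-distribʳ : ∀ f g h → ((g +ₛ h) *ₛ f) ≈ₛ ((g *ₛ f) +ₛ (h *ₛ f))
  *ₛ-distribʳ f g h n = trans (sumUpTo-cong n λ i _ → distribʳ (f (n ∸ i)) (g i) (h i))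
    (sumUpTo-+ n (λ i → g i * f (n ∸ i)) (λ i → h i * f (n ∸ i)))

  *ₛ-distribˡ : ∀ f g h → (f *ₛ (g +ₛ h)) ≈ₛ ((f *ₛ g) +ₛ (f *ₛ h))
  *ₛ-distribˡ f g h n = begin
    (f *ₛ (g +ₛ h)) n             ≈⟨ *ₛ-comm f (g +ₛ h) n ⟩
    ((g +ₛ h) *ₛ f) n             ≈⟨ *ₛ-distribʳ f g h n ⟩
    (g *ₛ f) n + (h *ₛ f) n       ≈⟨ +-cong (*ₛ-comm g f n) (*ₛ-comm h f n) ⟩
    (f *ₛ g) n + (f *ₛ h) n       ∎

  *ₛ-scaleˡ : ∀ a f g → ((λ i → a * f i) *ₛ g) ≈ₛ (λ n → a * (f *ₛ g) n)
  *ₛ-scaleˡ a f g n = trans (sumUpTo-cong n λ i _ → *-assoc _ _ _) (sym (*-distribˡ-sumUpTo n a _))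

  *ₛ-assoc : ∀ f g h → ((f *ₛ g) *ₛ h) ≈ₛ (f *ₛ (g *ₛ h))
  *ₛ-assoc f g h zero    = *-assoc _ _ _
  *ₛ-assoc f g h (suc n) = begin
    ((f *ₛ g) *ₛ h) (suc n)
      ≈⟨ *ₛ-suc n (f *ₛ g) h ⟩
    (f 0 * g 0) * h (suc n) + ((λ i → (f *ₛ g) (suc i)) *ₛ h) n
      ≈⟨ +-congˡ (*ₛ-cong {g = h} (λ i → *ₛ-suc i f g) (λ _ → refl) n) ⟩
    (f 0 * g 0) * h (suc n) + ((λ i → f 0 * g (suc i) + ((f ∘ suc) *ₛ g) i) *ₛ h) n
      ≈⟨ +-congˡ (*ₛ-distribʳ h (λ i → f 0 * g (suc i)) ((f ∘ suc) *ₛ g) n) ⟩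
    (f 0 * g 0) * h (suc n) + (((λ i → f 0 * g (suc i)) *ₛ h) n + (((f ∘ suc) *ₛ g) *ₛ h) n)
      ≈⟨ +-congˡ (+-cong (*ₛ-scaleˡ (f 0) (g ∘ suc) h n) (*ₛ-assoc (f ∘ suc) g h n)) ⟩
    (f 0 * g 0) * h (suc n) + (f 0 * ((g ∘ suc) *ₛ h) n + ((f ∘ suc) *ₛ (g *ₛ h)) n)
      ≈⟨ sym (+-assoc _ _ _) ⟩
    ((f 0 * g 0) * h (suc n) + f 0 * ((g ∘ suc) *ₛ h) n) + ((f ∘ suc) *ₛ (g *ₛ h)) n
      ≈⟨ +-congʳ (trans (+-congʳ (*-assoc _ _ _)) (sym (distribˡ (f 0) _ _))) ⟩
    f 0 * (g 0 * h (suc n) + ((g ∘ suc) *ₛ h) n) + ((f ∘ suc) *ₛ (g *ₛ h)) n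
      ≈⟨ +-congʳ (*-congˡ (sym (*ₛ-suc n g h))) ⟩
    f 0 * (g *ₛ h) (suc n) + ((f ∘ suc) *ₛ (g *ₛ h)) n
      ≈⟨ sym (*ₛ-suc n f (g *ₛ h)) ⟩
    (f *ₛ (g *ₛ h)) (suc n) ∎

  *ₛ-identityˡ : ∀ f → (1ₛ *ₛ f) ≈ₛ f
  *ₛ-identityˡ f zero    = *-identityˡ (f 0)
  *ₛ-identityˡ f (suc n) = begin
    (1ₛ *ₛ f) (suc n)                       ≈⟨ *ₛ-suc n 1ₛ f ⟩
    1# * f (suc n) + ((1ₛ ∘ suc) *ₛ f) n    ≈⟨ +-cong (*-identityˡ _) (sumUpTo-zero n λ i → zeroˡ _) ⟩
    f (suc n) + 0#                          ≈⟨ +-identityʳ _ ⟩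
    f (suc n)                               ∎

  powerSeriesRing : CommutativeRing c ℓ
  powerSeriesRing = record
    { Carrier = PS ; _≈_ = _≈ₛ_ ; _+_ = _+ₛ_ ; _*_ = _*ₛ_ ; -_ = -ₛ_ ; 0# = 0ₛ ; 1# = 1ₛ
    ; isCommutativeRing = record
      { isRing = record
        { +-isAbelianGroup = record
          { isGroup = record
            { isMonoid = record
              { isSemigroup = record
                { isMagma = record
                  { isEquivalence = record
                    { refl = λ n → refl
                    ; sym = λ f≈g n → sym (f≈g n)
                    ; trans = λ f≈g g≈h n → trans (f≈g n) (g≈h n) }
                  ; ∙-cong = λ f≈ g≈ n → +-cong (f≈ n) (g≈ n) }
                ; assoc = λ f g h n → +-assoc (f n) (g n) (h n) }
              ; identity = (λ f n → +-identityˡ (f n)) , (λ f n → +-identityʳ (f n)) }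
            ; inverse = (λ f n → -‿inverseˡ (f n)) , (λ f n → -‿inverseʳ (f n))
            ; ⁻¹-cong = λ f≈g n → -‿cong (f≈g n) }
          ; comm = λ f g n → +-comm (f n) (g n) }
        ; *-cong = *ₛ-cong
        ; *-assoc = *ₛ-assoc
        ; *-identity = *ₛ-identityˡ , (λ f n → trans (*ₛ-comm f 1ₛ n) (*ₛ-identityˡ f n))
        ; distrib = *ₛ-distribˡ , *ₛ-distribʳ }
      ; *-comm = *ₛ-comm } }

  FinitelySupported : PS → Set ℓ
  FinitelySupported f = ∃ λ N → ∀ n → N ≤ n → f n ≈ 0#

  finitelySupported-resp : ∀ {f g} → f ≈ₛ g → FinitelySupported f → FinitelySupported g
  finitelySupported-resp f≈g (N , f≈0) = N , λ n N≤n → trans (sym (f≈g n)) (f≈0 n N≤n)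

  finitelySupported-0ₛ : FinitelySupported 0ₛ
  finitelySupported-0ₛ = 0 , λ _ _ → refl

  finitelySupported-mono : ∀ a j → FinitelySupported (mono a j)
  finitelySupported-mono a j = suc j , λ n j<n → reflexive (≡.cong (λ b → if b then a else 0#)
    (dec-false (n ℕ.≟ j) λ n≡j → ℕₚ.<-irrefl (≡.sym n≡j) j<n))

  finitelySupported-neg : ∀ {f} → FinitelySupported f → FinitelySupported (-ₛ f)
  finitelySupported-neg (N , f≈0) = N , λ n N≤n → trans (-‿cong (f≈0 n N≤n)) -0#≈0#

  finitelySupported-+ : ∀ {f g} → FinitelySupported f → FinitelySupported g → FinitelySupported (f +ₛ g)
  finitelySupported-+ (N , f≈0) (M , g≈0) = N ℕ.+ M , λ n N+M≤n →
    trans (+-cong (f≈0 n (ℕₚ.m+n≤o⇒m≤o N N+M≤n)) (g≈0 n (ℕₚ.m+n≤o⇒n≤o N N+M≤n)))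
          (+-identityʳ 0#)

  finitelySupported-* : ∀ {f g} → FinitelySupported f → FinitelySupported g → FinitelySupported (f *ₛ g)
  finitelySupported-* {f} {g} (N , f≈0) (M , g≈0) = M ℕ.+ N , λ n M+N≤n → sumUpTo-zero n (term n M+N≤n)
    where
    term : ∀ n → M ℕ.+ N ≤ n → ∀ i → f i * g (n ∸ i) ≈ 0#
    term n M+N≤n i with N ℕ.≤? i
    ... | yes N≤i = trans (*-congʳ (f≈0 i N≤i)) (zeroˡ _)
    ... | no  N≰i = trans (*-congˡ (g≈0 (n ∸ i) (ℕₚ.m+n≤o⇒m≤o∸n M
                      (ℕₚ.≤-trans (ℕₚ.+-monoʳ-≤ M (ℕₚ.<⇒≤ (ℕₚ.≰⇒> N≰i))) M+N≤n)))) (zeroʳ _)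

  finitelySupported⇒polynomial : ∀ {f} → FinitelySupported f → ∃ λ P → f ≈ₛ poly P
  finitelySupported⇒polynomial {f} (N , f≈0) = applyUpTo f N , coefficients N f f≈0
    where
    coefficients : ∀ N f → (∀ n → N ≤ n → f n ≈ 0#) → f ≈ₛ poly (applyUpTo f N)
    coefficients zero    f f≈0 n       = f≈0 n z≤n
    coefficients (suc N) f f≈0 zero    = refl
    coefficients (suc N) f f≈0 (suc n) = coefficients N (f ∘ suc) (λ m N≤m → f≈0 (suc m) (s≤s N≤m)) n

  shift : ℕ → PS → PS
  shift zero    f n       = f n
  shift (suc p) f zero    = 0#
  shift (suc p) f (suc n) = shift p f n

  shift-≤ : ∀ p {n} f → p ≤ n → shift p f n ≡ f (n ∸ p)
  shift-≤ zero    f _         = ≡.refl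
  shift-≤ (suc p) f (s≤s p≤n) = shift-≤ p f p≤n

  shift-< : ∀ p {n} f → n < p → shift p f n ≡ 0#
  shift-< (suc p) {zero}  f _         = ≡.refl
  shift-< (suc p) {suc n} f (s≤s n<p) = shift-< p f n<p

  shift-zero : ∀ p {f} → f ≈ₛ 0ₛ → shift p f ≈ₛ 0ₛ
  shift-zero zero    f≈0 n       = f≈0 n
  shift-zero (suc p) f≈0 zero    = refl
  shift-zero (suc p) f≈0 (suc n) = shift-zero p f≈0 n

  mono-*ₛ : ∀ a p f → (mono a p *ₛ f) ≈ₛ (λ n → a * shift p f n)
  mono-*ₛ a zero    f zero    = refl
  mono-*ₛ a zero    f (suc n) = trans (*ₛ-suc n (mono a 0) f)
    (trans (+-congˡ (sumUpTo-zero n λ i → zeroˡ _)) (+-identityʳ _))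
  mono-*ₛ a (suc p) f zero    = trans (zeroˡ _) (sym (zeroʳ a))
  mono-*ₛ a (suc p) f (suc n) = trans (*ₛ-suc n (mono a (suc p)) f)
    (trans (+-cong (zeroˡ _) (mono-*ₛ a p f n)) (+-identityˡ _))

  shift-linearCombination : ∀ {K} (f : PS) a (κ : Fin K → Carrier) (h : Fin K → PS) →
    (∀ m → f m ≈ mono a 0 m + ∑[ i < K ] (κ i * h i m)) →
    ∀ p n → shift p f n ≈ mono a p n + ∑[ i < K ] (κ i * shift p (h i) n)
  shift-linearCombination f a κ h f≈ zero    n       = f≈ n
  shift-linearCombination f a κ h f≈ (suc p) zero    =
    sym (trans (+-identityˡ _) (∑-zero λ i → zeroʳ (κ i)))
  shift-linearCombination f a κ h f≈ (suc p) (suc n) = shift-linearCombination f a κ h f≈ p n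

  module ∑ₛ = Algebra.Properties.Semiring.Sum (CommutativeRing.semiring powerSeriesRing)

  ∑ₛ-apply : ∀ {K} (F : Fin K → PS) n → ∑ₛ.sum F n ≈ ∑[ i < K ] F i n
  ∑ₛ-apply {zero}  F n = refl
  ∑ₛ-apply {suc K} F n = +-congˡ (∑ₛ-apply (F ∘ suc) n)

module Compositions {c ℓ} (R : CommutativeRing c ℓ) where

  open CommutativeRing R hiding (zero)
  open Series R
  open Sums R
  open import Relation.Binary.Reasoning.Setoid setoid

  sumList-++ : ∀ xs ys → sumList (xs ++ ys) ≈ sumList xs + sumList ys
  sumList-++ []       ys = sym (+-identityˡ _)
  sumList-++ (x ∷ xs) ys = trans (+-congˡ (sumList-++ xs ys)) (sym (+-assoc _ _ _))

  sumList-cong : ∀ {A : Set} {F G : A → Carrier} xs → (∀ x → F x ≈ G x) →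
    sumList (map F xs) ≈ sumList (map G xs)
  sumList-cong []       F≈G = refl
  sumList-cong (x ∷ xs) F≈G = +-cong (F≈G x) (sumList-cong xs F≈G)

  sumList-zero : ∀ {A : Set} {F : A → Carrier} xs → (∀ x → F x ≈ 0#) → sumList (map F xs) ≈ 0#
  sumList-zero []       F≈0 = refl
  sumList-zero (x ∷ xs) F≈0 = trans (+-cong (F≈0 x) (sumList-zero xs F≈0)) (+-identityʳ 0#)

  *-distribˡ-sumList : ∀ {A : Set} a (F : A → Carrier) xs →
    a * sumList (map F xs) ≈ sumList (map (λ x → a * F x) xs)
  *-distribˡ-sumList a F []       = zeroʳ a
  *-distribˡ-sumList a F (x ∷ xs) = trans (distribˡ a _ _) (+-congˡ (*-distribˡ-sumList a F xs))

  sumList-filter : ∀ {A : Set} {p} {P : A → Set p} (P? : Decidable P) (F : A → Carrier) xs →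
    sumList (map F (filter P? xs)) ≈ sumList (map (λ x → if does (P? x) then F x else 0#) xs)
  sumList-filter P? F [] = refl
  sumList-filter P? F (x ∷ xs) with does (P? x)
  ... | true  = +-congˡ (sumList-filter P? F xs)
  ... | false = trans (sumList-filter P? F xs) (sym (+-identityˡ _))

  sumComps : ℕ → (List ℕ → Carrier) → Carrier
  sumComps n F = sumList (map F (comps n))

  nonEmpty-++ : ∀ xs ys → nonEmpty (xs ++ ys) ≡ nonEmpty xs ++ nonEmpty ys
  nonEmpty-++ []              ys = ≡.refl
  nonEmpty-++ ([] ∷ xs)       ys = nonEmpty-++ xs ys
  nonEmpty-++ ((p ∷ ps) ∷ xs) ys = ≡.cong ((p ∷ ps) ∷_) (nonEmpty-++ xs ys)

  nonEmpty-map-∷ : ∀ p xs → nonEmpty (map (p ∷_) xs) ≡ map (p ∷_) xs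
  nonEmpty-map-∷ p []       = ≡.refl
  nonEmpty-map-∷ p (x ∷ xs) = ≡.cong ((p ∷ x) ∷_) (nonEmpty-map-∷ p xs)

  nonEmpty-map-incHead : ∀ xs → nonEmpty (map incHead (nonEmpty xs)) ≡ map incHead (nonEmpty xs)
  nonEmpty-map-incHead []              = ≡.refl
  nonEmpty-map-incHead ([] ∷ xs)       = nonEmpty-map-incHead xs
  nonEmpty-map-incHead ((p ∷ ps) ∷ xs) = ≡.cong ((suc p ∷ ps) ∷_) (nonEmpty-map-incHead xs)

  nonEmpty-comps-suc : ∀ n → nonEmpty (comps (suc n)) ≡ comps (suc n)
  nonEmpty-comps-suc n = ≡.trans (nonEmpty-++ (map (1 ∷_) (comps n)) _)
    (≡.cong₂ _++_ (nonEmpty-map-∷ 1 (comps n)) (nonEmpty-map-incHead (comps n)))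

  sumList-map-++ : ∀ (F : List ℕ → Carrier) (f g : List ℕ → List ℕ) xs →
    sumList (map F (map f xs ++ map g xs)) ≈ sumList (map (F ∘ f) xs) + sumList (map (F ∘ g) xs)
  sumList-map-++ F f g xs = begin
    sumList (map F (map f xs ++ map g xs))
      ≡⟨ ≡.cong sumList (map-++ F (map f xs) (map g xs)) ⟩
    sumList (map F (map f xs) ++ map F (map g xs))
      ≈⟨ sumList-++ (map F (map f xs)) _ ⟩
    sumList (map F (map f xs)) + sumList (map F (map g xs))
      ≡⟨ ≡.sym (≡.cong₂ (λ as bs → sumList as + sumList bs) (map-∘ xs) (map-∘ xs)) ⟩
    sumList (map (F ∘ f) xs) + sumList (map (F ∘ g) xs) ∎

  -- Classify the compositions of n + 1 by their first part i + 1.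
  sumComps-suc : ∀ n F → sumComps (suc n) F ≈ sumUpTo n (λ i → sumComps (n ∸ i) (λ γ → F (suc i ∷ γ)))
  sumComps-suc zero    F = refl
  sumComps-suc (suc n) F = begin
    sumList (map F (map (1 ∷_) (comps (suc n)) ++ map incHead (nonEmpty (comps (suc n)))))
      ≡⟨ ≡.cong (λ cs → sumList (map F (map (1 ∷_) (comps (suc n)) ++ map incHead cs)))
                (nonEmpty-comps-suc n) ⟩
    sumList (map F (map (1 ∷_) (comps (suc n)) ++ map incHead (comps (suc n))))
      ≈⟨ sumList-map-++ F (1 ∷_) incHead (comps (suc n)) ⟩
    sumComps (suc n) (λ γ → F (1 ∷ γ)) + sumComps (suc n) (F ∘ incHead)
      ≈⟨ +-congˡ (sumComps-suc n (F ∘ incHead)) ⟩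
    sumComps (suc n) (λ γ → F (1 ∷ γ))
      + sumUpTo n (λ i → sumComps (n ∸ i) (λ γ → F (suc (suc i) ∷ γ)))
      ≈⟨ sym (sumUpTo-suc n λ i → sumComps (suc n ∸ i) (λ γ → F (suc i ∷ γ))) ⟩
    sumUpTo (suc n) (λ i → sumComps (suc n ∸ i) (λ γ → F (suc i ∷ γ))) ∎

module TCompositions {c ℓ} (R : CommutativeRing c ℓ) (b : CommutativeRing.Carrier R) (k : ℕ) where

  open CommutativeRing R hiding (zero)
  open Series R
  open Sums R
  open PowerSeries R
  open Compositions R
  open import Algebra.Properties.Semiring.Sum semiring using (sum-syntax; sum-cong-≋)
  open import Relation.Binary.Reasoning.Setoid setoid

  K : ℕ
  K = k ∸ 1

  t : Carrier
  t = pow b k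

  pow-+ : ∀ m n → pow b (m ℕ.+ n) ≈ pow b m * pow b n
  pow-+ zero    n = sym (*-identityˡ _)
  pow-+ (suc m) n = trans (*-congˡ (pow-+ m n)) (sym (*-assoc _ _ _))

  weight : List ℕ → Carrier
  weight β = if does (isT? k β) then pow b (k ℕ.* length β) else 0#

  -- link q p · x^p is the entry of A(x) in row q and column p: the factor gained by putting a first
  -- part p in front of a T-composition starting with q.
  link : ℕ → ℕ → Carrier
  link q p = if does (k ℕ.≤? q ℕ.+ p) then t else 0#

  C≈sumComps : ∀ n → C b k n ≈ sumComps n weight
  C≈sumComps n = sumList-filter (isT? k) (λ β → pow b (k ℕ.* length β)) (comps n)

  weight-[] : weight [] ≈ 1#
  weight-[] = reflexive (≡.cong (pow b) (ℕₚ.*-zeroʳ k))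

  weight-large : ∀ {p} → ¬ p ≤ K → ∀ γ → weight (p ∷ γ) ≈ 0#
  weight-large {p} p≰K γ = reflexive (≡.cong (λ x → if x then pow b (k ℕ.* length (p ∷ γ)) else 0#)
    (dec-false (isT? k (p ∷ γ)) λ ((p≤K , _) , _) → p≰K p≤K))

  weight-[_] : ∀ {p} → p ≤ K → weight (p ∷ []) ≈ t
  weight-[_] {p} p≤K = reflexive (≡.trans
    (≡.cong (λ x → if x then pow b (k ℕ.* 1) else 0#) (dec-true (isT? k (p ∷ [])) ((p≤K , _) , _)))
    (≡.cong (pow b) (ℕₚ.*-identityʳ k)))

  isT-∷-∷ : ∀ {p q δ} → p ≤ K → IsT k (p ∷ q ∷ δ) ⇔ (k ≤ q ℕ.+ p × IsT k (q ∷ δ))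
  isT-∷-∷ {p} {q} p≤K = mk⇔
    (λ ((_ , small) , (k≤p+q , big)) → ≡.subst (k ≤_) (ℕₚ.+-comm p q) k≤p+q , (small , big))
    (λ (k≤q+p , (small , big)) → (p≤K , small) , (≡.subst (k ≤_) (ℕₚ.+-comm q p) k≤q+p , big))

  weight-∷-∷ : ∀ {p q δ} → p ≤ K → weight (p ∷ q ∷ δ) ≈ link q p * weight (q ∷ δ)
  weight-∷-∷ {p} {q} {δ} p≤K = begin
    weight (p ∷ q ∷ δ)
      ≡⟨ ≡.cong (λ x → if x then pow b (k ℕ.* suc (suc (length δ))) else 0#)
           (does-⇔ (isT-∷-∷ p≤K) (isT? k (p ∷ q ∷ δ)) ((k ℕ.≤? q ℕ.+ p) ×-dec isT? k (q ∷ δ))) ⟩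
    (if does (k ℕ.≤? q ℕ.+ p) ∧ does (isT? k (q ∷ δ)) then pow b (k ℕ.* suc (suc (length δ))) else 0#)
      ≈⟨ split (does (k ℕ.≤? q ℕ.+ p)) (does (isT? k (q ∷ δ))) ⟩
    link q p * weight (q ∷ δ) ∎
    where
    split : ∀ x y → (if x ∧ y then pow b (k ℕ.* suc (suc (length δ))) else 0#)
                  ≈ (if x then t else 0#) * (if y then pow b (k ℕ.* suc (length δ)) else 0#)
    split false y     = sym (zeroˡ _)
    split true  false = sym (zeroʳ t)
    split true  true  = trans (reflexive (≡.cong (pow b) (ℕₚ.*-suc k (suc (length δ)))))
                              (pow-+ k (k ℕ.* suc (length δ)))

  -- firstPartWeight p m is the total weight of the T-compositions of p + m with first part p.
  firstPartWeight : ℕ → PS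
  firstPartWeight p m = sumComps m λ γ → weight (p ∷ γ)

  firstPartWeight-large : ∀ {p} → ¬ p ≤ K → firstPartWeight p ≈ₛ 0ₛ
  firstPartWeight-large p≰K m = sumList-zero (comps m) (weight-large p≰K)

  firstPartWeight-zero : ∀ {p} → p ≤ K → firstPartWeight p 0 ≈ t
  firstPartWeight-zero p≤K = trans (+-identityʳ _) weight-[ p≤K ]

  firstPartWeight-suc : ∀ {p} → p ≤ K → ∀ m →
    firstPartWeight p (suc m) ≈ sumUpTo m (λ q → link (suc q) p * firstPartWeight (suc q) (m ∸ q))
  firstPartWeight-suc {p} p≤K m = trans (sumComps-suc m λ γ → weight (p ∷ γ)) (sumUpTo-cong m λ q _ →
    trans (sumList-cong (comps (m ∸ q)) (λ δ → weight-∷-∷ {δ = δ} p≤K))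
          (sym (*-distribˡ-sumList (link (suc q) p) (λ δ → weight (suc q ∷ δ)) (comps (m ∸ q)))))

  firstPartSeries : ℕ → PS
  firstPartSeries p = shift p (firstPartWeight p)

  series : Fin K → PS
  series i = firstPartSeries (suc (toℕ i))

  sumUpTo-firstParts : ∀ m (κ : ℕ → Carrier) →
    sumUpTo m (λ q → κ q * firstPartWeight (suc q) (m ∸ q)) ≈ ∑[ i < K ] (κ (toℕ i) * series i (suc m))
  sumUpTo-firstParts m κ = trans
    (sumUpTo-cong m λ q q≤m → *-congˡ (reflexive (≡.sym (shift-≤ q (firstPartWeight (suc q)) q≤m))))
    (sumUpTo-as-∑ m K (λ q → κ q * firstPartSeries (suc q) (suc m))
      (λ q m<q → trans (*-congˡ (reflexive (shift-< q _ m<q))) (zeroʳ _))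
      (λ q K≤q → trans (*-congˡ (shift-zero q (firstPartWeight-large λ q<K → ℕₚ.<⇒≱ q<K K≤q) m))
                       (zeroʳ _)))

  C≈1+∑series : C b k ≈ₛ (1ₛ +ₛ ∑ₛ.sum series)
  C≈1+∑series zero = begin
    C b k 0                   ≈⟨ C≈sumComps 0 ⟩
    weight [] + 0#            ≈⟨ +-congʳ weight-[] ⟩
    1# + 0#                   ≈⟨ +-congˡ (sym (trans (∑ₛ-apply series 0) (∑-zero {K} λ i → refl))) ⟩
    1# + ∑ₛ.sum series 0      ∎
  C≈1+∑series (suc m) = begin
    C b k (suc m)
      ≈⟨ C≈sumComps (suc m) ⟩
    sumComps (suc m) weight
      ≈⟨ sumComps-suc m weight ⟩
    sumUpTo m (λ q → firstPartWeight (suc q) (m ∸ q))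
      ≈⟨ sumUpTo-cong m (λ q _ → sym (*-identityˡ _)) ⟩
    sumUpTo m (λ q → 1# * firstPartWeight (suc q) (m ∸ q))
      ≈⟨ sumUpTo-firstParts m (λ _ → 1#) ⟩
    ∑[ i < K ] (1# * series i (suc m))
      ≈⟨ sum-cong-≋ (λ i → *-identityˡ (series i (suc m))) ⟩
    ∑[ i < K ] series i (suc m)
      ≈⟨ sym (trans (+-identityˡ _) (∑ₛ-apply series (suc m))) ⟩
    0# + ∑ₛ.sum series (suc m) ∎

  firstPartWeight-recurrence : ∀ {p} → p ≤ K → ∀ m →
    firstPartWeight p m ≈ mono t 0 m + ∑[ i < K ] (link (suc (toℕ i)) p * series i m)
  firstPartWeight-recurrence {p} p≤K zero    = trans (firstPartWeight-zero p≤K)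
    (sym (trans (+-congˡ (∑-zero {K} λ i → zeroʳ (link (suc (toℕ i)) p))) (+-identityʳ t)))
  firstPartWeight-recurrence {p} p≤K (suc m) =
    trans (firstPartWeight-suc p≤K m) (trans (sumUpTo-firstParts m λ q → link (suc q) p) (sym (+-identityˡ _)))

  *ₛ-A : ∀ f i s n → (f *ₛ A b k i s) n ≈ link (suc (toℕ i)) (suc (toℕ s)) * shift (suc (toℕ s)) f n
  *ₛ-A f i s n = entry (does (k ℕ.≤? suc (toℕ i) ℕ.+ suc (toℕ s)))
    where
    p = suc (toℕ s)
    entry : ∀ x → (f *ₛ (if x then mono t p else 0ₛ)) n ≈ (if x then t else 0#) * shift p f n
    entry true  = trans (*ₛ-comm f (mono t p) n) (mono-*ₛ t p f n)
    entry false = trans (sumUpTo-zero n λ i → zeroʳ _) (sym (zeroˡ _))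

  u : Fin K → PS
  u s = mono t (suc (toℕ s))

  series-system : ∀ s → series s ≈ₛ (u s +ₛ ∑ₛ.sum λ i → series i *ₛ A b k i s)
  series-system s n = begin
    shift p (firstPartWeight p) n
      ≈⟨ shift-linearCombination (firstPartWeight p) t (λ i → link (suc (toℕ i)) p) series
           (firstPartWeight-recurrence (toℕ<n s)) p n ⟩
    mono t p n + ∑[ i < K ] (link (suc (toℕ i)) p * shift p (series i) n)
      ≈⟨ +-congˡ (sum-cong-≋ λ i → sym (*ₛ-A (series i) i s n)) ⟩
    mono t p n + ∑[ i < K ] (series i *ₛ A b k i s) n
      ≈⟨ +-congˡ (sym (∑ₛ-apply (λ i → series i *ₛ A b k i s) n)) ⟩
    u s n + ∑ₛ.sum (λ i → series i *ₛ A b k i s) n ∎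
    where p = suc (toℕ s)

module TransferMatrix {c ℓ} (R : CommutativeRing c ℓ) (b : CommutativeRing.Carrier R) (k : ℕ) where

  open PowerSeries R
  open TCompositions R b k using (K; u; series; series-system; C≈1+∑series)
  module S = Series R
  open CommutativeRing powerSeriesRing hiding (zero)
  open import Algebra.Properties.Ring ring using (-‿distribʳ-*)
  open import Algebra.Properties.Semiring.Sum semiring
    using (sum; sum-syntax; sum-cong-≋; ∑-distrib-+; *-distribˡ-sum)
  open Sums powerSeriesRing using (-‿∑; ∑-single)
  open Determinant powerSeriesRing
  open import Relation.Binary.Reasoning.Setoid setoid

  sumFin≈sum : ∀ n {f g : Fin n → S.PS} → (∀ i → f i ≈ g i) → S.sumFin n f ≈ sum g
  sumFin≈sum zero    f≈g = refl
  sumFin≈sum (suc n) f≈g = +-cong (f≈g zero) (sumFin≈sum n (f≈g ∘ suc))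

  sign≈sign : ∀ {n} (j : Fin n) {x y} → x ≈ y → S.sign j x ≈ sign j y
  sign≈sign zero    x≈y = x≈y
  sign≈sign (suc j) x≈y = -‿cong (sign≈sign j x≈y)

  Series-det≈det : ∀ n (M : Matrix n) → S.det n M ≈ det n M
  Series-det≈det zero    M = refl
  Series-det≈det (suc n) M = sumFin≈sum (suc n) λ j →
    sign≈sign j (*-congˡ {M zero j} (Series-det≈det n (minor zero j M)))

  I-A : Matrix K
  I-A = S.IminusA b k

  identity-entry : Fin K → Fin K → S.PS
  identity-entry i s = if does (toℕ i ℕ.≟ toℕ s) then S.1ₛ else S.0ₛ

  identity-entry-≢ : ∀ {i s} → i ≢ s → identity-entry i s ≡ S.0ₛ
  identity-entry-≢ {i} {s} i≢s =
    ≡.cong (λ x → if x then S.1ₛ else S.0ₛ) (dec-false (toℕ i ℕ.≟ toℕ s) (i≢s ∘ toℕ-injective))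

  identity-entry-≡ : ∀ s → identity-entry s s ≡ S.1ₛ
  identity-entry-≡ s = ≡.cong (λ x → if x then S.1ₛ else S.0ₛ) (dec-true (toℕ s ℕ.≟ toℕ s) ≡.refl)

  ∑-series-*-identity : ∀ s → ∑[ i < K ] (series i * identity-entry i s) ≈ series s
  ∑-series-*-identity s = begin
    ∑[ i < K ] (series i * identity-entry i s)
      ≈⟨ ∑-single s (λ i → series i * identity-entry i s) (λ i i≢s →
           trans (*-congˡ (reflexive (identity-entry-≢ i≢s))) (zeroʳ (series i))) ⟩
    series s * identity-entry s s
      ≡⟨ ≡.cong (series s *_) (identity-entry-≡ s) ⟩
    series s * 1#
      ≈⟨ *-identityʳ (series s) ⟩
    series s ∎

  u≈series*[I-A] : ∀ s → u s ≈ ∑[ i < K ] (series i * I-A i s)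
  u≈series*[I-A] s = sym (begin
    ∑[ i < K ] (series i * (identity-entry i s + - A i s))
      ≈⟨ sum-cong-≋ (λ i → trans (distribˡ (series i) (identity-entry i s) (- A i s))
                                  (+-congˡ (sym (-‿distribʳ-* (series i) (A i s))))) ⟩
    ∑[ i < K ] (series i * identity-entry i s + - (series i * A i s))
      ≈⟨ ∑-distrib-+ (λ i → series i * identity-entry i s) (λ i → - (series i * A i s)) ⟩
    ∑[ i < K ] (series i * identity-entry i s) + ∑[ i < K ] (- (series i * A i s))
      ≈⟨ +-cong (∑-series-*-identity s) (sym (-‿∑ λ i → series i * A i s)) ⟩
    series s - ∑[ i < K ] (series i * A i s)
      ≈⟨ +-congʳ (series-system s) ⟩
    (u s + ∑[ i < K ] (series i * A i s)) - ∑[ i < K ] (series i * A i s)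
      ≈⟨ +-assoc _ _ _ ⟩
    u s + (∑[ i < K ] (series i * A i s) - ∑[ i < K ] (series i * A i s))
      ≈⟨ +-congˡ (-‿inverseʳ _) ⟩
    u s + 0#
      ≈⟨ +-identityʳ (u s) ⟩
    u s ∎)
    where A = S.A b k

  det[I-A]*C : S.detIminusA b k * S.C b k ≈ det K I-A + ∑[ j < K ] det K (replaceRow j u I-A)
  det[I-A]*C = begin
    S.detIminusA b k * S.C b k
      ≈⟨ *-cong (Series-det≈det K I-A) C≈1+∑series ⟩
    D * (1# + ∑[ j < K ] series j)
      ≈⟨ distribˡ D 1# (∑[ j < K ] series j) ⟩
    D * 1# + D * ∑[ j < K ] series j
      ≈⟨ +-cong (*-identityʳ D) (*-distribˡ-sum D series) ⟩
    D + ∑[ j < K ] (D * series j)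
      ≈⟨ +-congˡ (sum-cong-≋ λ j → trans (*-comm D (series j))
                                          (sym (cramer K I-A series u u≈series*[I-A] j))) ⟩
    D + ∑[ j < K ] det K (replaceRow j u I-A) ∎
    where D = det K I-A

  open Closure FinitelySupported finitelySupported-0ₛ (finitelySupported-mono _ 0)
               finitelySupported-neg finitelySupported-+ finitelySupported-*

  finitelySupported-I-A : ∀ i s → FinitelySupported (I-A i s)
  finitelySupported-I-A i s = finitelySupported-+
    (finitelySupported-if (does (toℕ i ℕ.≟ toℕ s)) (finitelySupported-mono _ 0) finitelySupported-0ₛ)
    (finitelySupported-neg (finitelySupported-if (does (k ℕ.≤? suc (toℕ i) ℕ.+ suc (toℕ s)))
      (finitelySupported-mono _ _) finitelySupported-0ₛ))
    where
    finitelySupported-if : ∀ x {f g} → FinitelySupported f → FinitelySupported g →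
      FinitelySupported (if x then f else g)
    finitelySupported-if true  f-fs _    = f-fs
    finitelySupported-if false _    g-fs = g-fs

  finitelySupported-det[I-A]*C : FinitelySupported (S.detIminusA b k * S.C b k)
  finitelySupported-det[I-A]*C = finitelySupported-resp (sym det[I-A]*C) (finitelySupported-+
    (det-closed K I-A finitelySupported-I-A)
    (∑-closed _ λ j → det-closed K _
      (replaceRow-closed j u I-A (λ s → finitelySupported-mono _ _) finitelySupported-I-A)))

proposition2p8 : ∀ {c ℓ} (R : CommutativeRing c ℓ) (b : CommutativeRing.Carrier R)
    (k : ℕ) → 2 ≤ k →
    ∃ λ (P : List (CommutativeRing.Carrier R)) → ∀ (n : ℕ) →
      CommutativeRing._≈_ R
        (Series._*ₛ_ R (Series.detIminusA R b k) (Series.C R b k) n)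
        (Series.poly R P n)
proposition2p8 R b k _ = finitelySupported⇒polynomial finitelySupported-det[I-A]*C
  where
  open PowerSeries R
  open TransferMatrix R b k
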